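{- Let $(P,\leq,{}',0,1)$ be a poset with complementation. Then for all $x,y\in P$, \[L(U(L(x,y),y'),y)\supseteq L(x,y)\quad\text{and}\quad U(L(U(x,y),y'),y)\supseteq U(x,y).\]
   Context: For a poset $(P,\leq)$ and $A\subseteq P$ let $L(A)=\{x\in P\mid x\leq y\text{ for all }y\in A\}$ and $U(A)=\{x\in P\mid y\leq x\text{ for all }y\in A\}$; we write $L(a,b)$ for $L(\{a,b\})$, $L(A,a)$ for $L(A\cup\{a\})$, etc., and similarly for $U$. A poset with complementation is $(P,\leq,{}',0,1)$ with $(P,\leq,0,1)$ a bounded poset and $'$ a unary operation such that for all $x,y$: $L(x,x')=\{0\}$ and $U(x,x')=\{1\}$; $x\leq y$ implies $y'\leq x'$; $(x')'=x$. -}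

module Defs where

open import Level using (Level; _⊔_; suc)
open import Data.Product using (_×_)
open import Relation.Binary.Bundles using (Poset)

Subset : ∀ {a} (A : Set a) (ℓ : Level) → Set (a ⊔ suc ℓ)
Subset A ℓ = A → Set ℓ

record ComplementedPoset (c ℓ₁ ℓ₂ : Level) : Set (suc (c ⊔ ℓ₁ ⊔ ℓ₂)) where
  field
    poset : Poset c ℓ₁ ℓ₂
  open Poset poset public
  field
    𝟘 𝟙 : Carrier
    _′ : Carrier → Carrier
    𝟘-least : ∀ x → 𝟘 ≤ x
    𝟙-greatest : ∀ x → x ≤ 𝟙
    -- L(x, x') = {0}  (0 belongs to it automatically since it is least)
    L-compl : ∀ x z → z ≤ x → z ≤ x ′ → z ≈ 𝟘
    U-compl : ∀ x z → x ≤ z → x ′ ≤ z → z ≈ 𝟙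
    antitone : ∀ {x y} → x ≤ y → y ′ ≤ x ′
    involutive : ∀ x → (x ′) ′ ≈ x

  L : ∀ {ℓ} → Subset Carrier ℓ → Subset Carrier (c ⊔ ℓ ⊔ ℓ₂)
  L A x = ∀ y → A y → x ≤ y

  U : ∀ {ℓ} → Subset Carrier ℓ → Subset Carrier (c ⊔ ℓ ⊔ ℓ₂)
  U A x = ∀ y → A y → y ≤ x

  L₂ : Carrier → Carrier → Subset Carrier ℓ₂
  L₂ a b x = x ≤ a × x ≤ b

  U₂ : Carrier → Carrier → Subset Carrier ℓ₂
  U₂ a b x = a ≤ x × b ≤ x

  -- L(A, a) = L(A ∪ {a}),  U(A, a) = U(A ∪ {a})
  L⁺ : ∀ {ℓ} → Subset Carrier ℓ → Carrier → Subset Carrier (c ⊔ ℓ ⊔ ℓ₂)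
  L⁺ A a x = L A x × x ≤ a

  U⁺ : ∀ {ℓ} → Subset Carrier ℓ → Carrier → Subset Carrier (c ⊔ ℓ ⊔ ℓ₂)
  U⁺ A a x = U A x × a ≤ x

module Submission where

-- Both inclusions are instances of the Galois-connection inequality
-- A ⊆ L(U(A)) (dually A ⊆ U(L(A))): every element of A lies below every
-- upper bound of A, and enlarging the set of which we take upper bounds
-- (here by adding y') only shrinks U and so keeps the inequality.  For the
-- remaining conjunct of L(U(L(x,y),y'),y) it suffices that an element of
-- L(x,y) lies below y, and dually.

open import Defs
open import Level using (Level)
open import Data.Product using (_×_; _,_; proj₂)

module Cones {c ℓ₁ ℓ₂ : Level} (P : ComplementedPoset c ℓ₁ ℓ₂) where
  open ComplementedPoset P

  ⊆-L-U⁺ : ∀ {ℓ} (A : Subset Carrier ℓ) (a : Carrier) →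
    ∀ z → A z → L (U⁺ A a) z
  ⊆-L-U⁺ A a z z∈A w (w∈UA , _) = w∈UA z z∈A

  ⊆-U-L⁺ : ∀ {ℓ} (A : Subset Carrier ℓ) (a : Carrier) →
    ∀ z → A z → U (L⁺ A a) z
  ⊆-U-L⁺ A a z z∈A w (w∈LA , _) = w∈LA z z∈A

lemma2 : ∀ {c ℓ₁ ℓ₂ : Level} (P : ComplementedPoset c ℓ₁ ℓ₂) →
    let open ComplementedPoset P in
    ∀ (x y : Carrier) →
    (∀ z → L₂ x y z → L⁺ (U⁺ (L₂ x y) (y ′)) y z) ×
    (∀ z → U₂ x y z → U⁺ (L⁺ (U₂ x y) (y ′)) y z)
lemma2 P x y =
  (λ z z∈Lxy → ⊆-L-U⁺ (L₂ x y) (y ′) z z∈Lxy , proj₂ z∈Lxy) ,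
  (λ z z∈Uxy → ⊆-U-L⁺ (U₂ x y) (y ′) z z∈Uxy , proj₂ z∈Uxy)
  where
    open ComplementedPoset P
    open Cones P
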